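{- Let $R\subseteq\{0,1\}^V$ be a relation that is not closed under joins (there exist $x,y\in R$ with $x\vee y\notin R$), such that for every partial configuration $p$ of $V$ with non-empty domain the pinning $R_p$ is closed under joins. Then $R=\{\mathbf0,x,\overline{x}\}$ or $R=\{x,\overline{x}\}$ for some configuration $x$.
   Context: $\vee$ denotes coordinatewise maximum; $\mathbf0$ is the all-zero configuration; $\overline{x}_i=1-x_i$. A partial configuration $p$ of $V$ is an element of $\{0,1\}^{\operatorname{dom}(p)}$ with $\operatorname{dom}(p)\subseteq V$; the pinning $R_p\subseteq\{0,1\}^{V\setminus\operatorname{dom}(p)}$ is defined by $x\in R_p\iff(x,p)\in R$. -}

module Defs where

open import Data.Bool using (Bool; true; false; _∨_; not)
open import Data.Maybe using (Maybe; just; nothing)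
open import Data.Nat using (ℕ)
open import Data.Fin using (Fin)
open import Data.Vec using (Vec; zipWith; replicate; map; lookup)
open import Data.Product using (∃; ∃-syntax; _×_)
open import Relation.Binary.PropositionalEquality using (_≡_)
open import Relation.Unary using (Pred)
open import Level using (0ℓ)

-- V = Fin n; a configuration is an element of {0,1}^V
Config : ℕ → Set
Config n = Vec Bool n

Relation : ℕ → Set₁
Relation n = Pred (Config n) 0ℓ

_⋁_ : ∀ {n} → Config n → Config n → Config n
x ⋁ y = zipWith _∨_ x y

𝟎 : ∀ {n} → Config n
𝟎 {n} = replicate n false

‾_ : ∀ {n} → Config n → Config n
‾ x = map not x

JoinClosed : ∀ {n} → Relation n → Set
JoinClosed R = ∀ x y → R x → R y → R (x ⋁ y)

-- a partial configuration p of V: nothing = coordinate outside dom(p)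
PartialConfig : ℕ → Set
PartialConfig n = Vec (Maybe Bool) n

NonEmptyDom : ∀ {n} → PartialConfig n → Set
NonEmptyDom p = ∃[ i ] ∃[ b ] (lookup p i ≡ just b)

-- x is the configuration (x', p) for some x' ∈ {0,1}^(V ∖ dom p),
-- i.e. x agrees with p on dom(p)
Extends : ∀ {n} → PartialConfig n → Config n → Set
Extends p x = ∀ i b → lookup p i ≡ just b → lookup x i ≡ b

-- the pinning R_p, with {0,1}^(V ∖ dom p) identified with the set of full
-- configurations extending p (the join on the free coordinates corresponds
-- to the full join, since extensions of p agree on dom p)
PinningJoinClosed : ∀ {n} → Relation n → PartialConfig n → Set
PinningJoinClosed R p =
  ∀ x y → Extends p x → Extends p y → R x → R y → R (x ⋁ y)

module Submission where

-- Pin a single coordinate i to the common value of two members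
-- a, b of R: both extend that partial configuration, so the hypothesis says
-- a ⋁ b ∈ R.  Hence R is closed under joins of configurations that AGREE
-- somewhere (`AgreeingJoinClosed`).  For such an R:
--   * if x, y ∈ R but x ⋁ y ∉ R, then x and y agree nowhere, i.e. y = x̄;
--   * if moreover z ∈ R is neither x nor x̄ nor 𝟎, then z agrees with both x
--     and x̄ somewhere, so x ⋁ z and x̄ ⋁ z lie in R; they share a coordinate
--     where z is true, so their join x ⋁ x̄ lies in R — a contradiction.
-- So R ⊆ {𝟎, x, x̄} with x, x̄ ∈ R, and deciding whether 𝟎 ∈ R picks the
-- disjunct of the conclusion.

open import Defs
open import Data.Bool using (Bool; true; false; _∨_)
open import Data.Bool.Properties using (∨-zeroʳ)
open import Data.Empty using (⊥-elim)
open import Data.Fin using (Fin; zero; suc)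
open import Data.Maybe using (just; nothing)
open import Data.Nat using (ℕ; suc)
open import Data.Product using (∃-syntax; _×_; _,_)
open import Data.Sum using (_⊎_; inj₁; inj₂)
open import Data.Vec using ([]; _∷_; lookup; replicate)
open import Data.Vec.Properties using (lookup-replicate; lookup-zipWith)
open import Function.Bundles using (_⇔_; mk⇔)
open import Relation.Binary.PropositionalEquality
  using (_≡_; refl; sym; trans; cong; subst; module ≡-Reasoning)
open import Relation.Nullary using (¬_; yes; no)
open import Relation.Unary using (Decidable)

complement-or-agree : ∀ {n} (x y : Config n) →
                      y ≡ ‾ x ⊎ ∃[ i ] (lookup x i ≡ lookup y i)
complement-or-agree []          []          = inj₁ refl
complement-or-agree (false ∷ x) (false ∷ y) = inj₂ (zero , refl)
complement-or-agree (true  ∷ x) (true  ∷ y) = inj₂ (zero , refl)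
complement-or-agree (false ∷ x) (true  ∷ y) with complement-or-agree x y
... | inj₁ y≡x̄       = inj₁ (cong (true ∷_) y≡x̄)
... | inj₂ (i , agree) = inj₂ (suc i , agree)
complement-or-agree (true  ∷ x) (false ∷ y) with complement-or-agree x y
... | inj₁ y≡x̄       = inj₁ (cong (false ∷_) y≡x̄)
... | inj₂ (i , agree) = inj₂ (suc i , agree)

‾-involutive : ∀ {n} (x : Config n) → ‾ (‾ x) ≡ x
‾-involutive []          = refl
‾-involutive (false ∷ x) = cong (false ∷_) (‾-involutive x)
‾-involutive (true  ∷ x) = cong (true ∷_) (‾-involutive x)

zero-or-true : ∀ {n} (z : Config n) → z ≡ 𝟎 ⊎ ∃[ j ] (lookup z j ≡ true)
zero-or-true []          = inj₁ refl
zero-or-true (true  ∷ z) = inj₂ (zero , refl)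
zero-or-true (false ∷ z) with zero-or-true z
... | inj₁ z≡𝟎        = inj₁ (cong (false ∷_) z≡𝟎)
... | inj₂ (j , zj≡1) = inj₂ (suc j , zj≡1)

⋁-keeps-true : ∀ {n} (x z : Config n) j → lookup z j ≡ true →
               lookup (x ⋁ z) j ≡ true
⋁-keeps-true x z j zj≡1 = begin
  lookup (x ⋁ z) j            ≡⟨ lookup-zipWith _∨_ j x z ⟩
  lookup x j ∨ lookup z j     ≡⟨ cong (lookup x j ∨_) zj≡1 ⟩
  lookup x j ∨ true           ≡⟨ ∨-zeroʳ (lookup x j) ⟩
  true                        ∎
  where open ≡-Reasoning

⋁-complement-absorbs : ∀ {n} (x z : Config n) →
                       (x ⋁ z) ⋁ ((‾ x) ⋁ z) ≡ x ⋁ (‾ x)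
⋁-complement-absorbs []          []          = refl
⋁-complement-absorbs (false ∷ x) (false ∷ z) = cong (true ∷_) (⋁-complement-absorbs x z)
⋁-complement-absorbs (false ∷ x) (true  ∷ z) = cong (true ∷_) (⋁-complement-absorbs x z)
⋁-complement-absorbs (true  ∷ x) (false ∷ z) = cong (true ∷_) (⋁-complement-absorbs x z)
⋁-complement-absorbs (true  ∷ x) (true  ∷ z) = cong (true ∷_) (⋁-complement-absorbs x z)

pin : ∀ {n} → Fin n → Bool → PartialConfig n
pin {suc n} zero    b = just b ∷ replicate n nothing
pin         (suc i) b = nothing ∷ pin i b

pin-nonEmpty : ∀ {n} (i : Fin n) b → NonEmptyDom (pin i b)
pin-nonEmpty i b = i , b , pinned i b
  where
  pinned : ∀ {n} (i : Fin n) b → lookup (pin i b) i ≡ just b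
  pinned zero    b = refl
  pinned (suc i) b = pinned i b

pin-extends : ∀ {n} (i : Fin n) (x : Config n) b → lookup x i ≡ b →
              Extends (pin i b) x
pin-extends zero    (a ∷ x) b xi≡b zero    c refl = xi≡b
pin-extends zero    (a ∷ x) b xi≡b (suc j) c pj≡c
  with () ← trans (sym (lookup-replicate j nothing)) pj≡c
pin-extends (suc i) (a ∷ x) b xi≡b (suc j) c pj≡c = pin-extends i x b xi≡b j c pj≡c

AgreeingJoinClosed : ∀ {n} → Relation n → Set
AgreeingJoinClosed R =
  ∀ a b i → lookup a i ≡ lookup b i → R a → R b → R (a ⋁ b)

-- Join-closed nonempty pinnings give closure under agreeing joins: two
-- members agreeing at i both extend the pinning of i to their common value.
pinnings⇒agreeingJoinClosed : ∀ {n} (R : Relation n) →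
  ((p : PartialConfig n) → NonEmptyDom p → PinningJoinClosed R p) →
  AgreeingJoinClosed R
pinnings⇒agreeingJoinClosed R pinClosed a b i agree =
  pinClosed (pin i (lookup a i)) (pin-nonEmpty i (lookup a i)) a b
            (pin-extends i a (lookup a i) refl) (pin-extends i b (lookup a i) (sym agree))

module _ {n} {R : Relation n} (closed : AgreeingJoinClosed R) where

  nonJoinable⇒complement : ∀ {x y} → R x → R y → ¬ R (x ⋁ y) → y ≡ ‾ x
  nonJoinable⇒complement {x} {y} Rx Ry ¬Rx⋁y with complement-or-agree x y
  ... | inj₁ y≡x̄       = y≡x̄
  ... | inj₂ (i , agree) = ⊥-elim (¬Rx⋁y (closed x y i agree Rx Ry))

  members⊆𝟎-x-x̄ : ∀ {x} → R x → R (‾ x) → ¬ R (x ⋁ (‾ x)) →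
                  ∀ z → R z → z ≡ 𝟎 ⊎ z ≡ x ⊎ z ≡ ‾ x
  members⊆𝟎-x-x̄ {x} Rx Rx̄ ¬Rx⋁x̄ z Rz
    with complement-or-agree x z | complement-or-agree (‾ x) z | zero-or-true z
  ... | inj₁ z≡x̄      | _              | _       = inj₂ (inj₂ z≡x̄)
  ... | inj₂ _         | inj₁ z≡x̿      | _       = inj₂ (inj₁ (trans z≡x̿ (‾-involutive x)))
  ... | inj₂ _         | inj₂ _         | inj₁ z≡𝟎 = inj₁ z≡𝟎
  ... | inj₂ (i , x~z) | inj₂ (i' , x̄~z) | inj₂ (j , zj≡1) =
    ⊥-elim (¬Rx⋁x̄ (subst R (⋁-complement-absorbs x z) R-both))
    where
    -- x ⋁ z and x̄ ⋁ z are members agreeing at j (both are 1 there).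
    R-both : R ((x ⋁ z) ⋁ ((‾ x) ⋁ z))
    R-both = closed (x ⋁ z) ((‾ x) ⋁ z) j
               (trans (⋁-keeps-true x z j zj≡1) (sym (⋁-keeps-true (‾ x) z j zj≡1)))
               (closed x z i x~z Rx Rz) (closed (‾ x) z i' x̄~z Rx̄ Rz)

shape-of-relation : ∀ {n} {R : Relation n} {x : Config n} → Decidable R → R x → R (‾ x) →
  (∀ z → R z → z ≡ 𝟎 ⊎ z ≡ x ⊎ z ≡ ‾ x) →
  (∀ y → R y ⇔ (y ≡ 𝟎 ⊎ y ≡ x ⊎ y ≡ ‾ x)) ⊎ (∀ y → R y ⇔ (y ≡ x ⊎ y ≡ ‾ x))
shape-of-relation {R = R} {x} R? Rx Rx̄ members with R? 𝟎
... | yes R𝟎 = inj₁ λ y → mk⇔ (members y) λ where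
  (inj₁ refl)        → R𝟎
  (inj₂ (inj₁ refl)) → Rx
  (inj₂ (inj₂ refl)) → Rx̄
... | no ¬R𝟎 = inj₂ λ y → mk⇔ (nonzero-member y) (λ where
  (inj₁ refl) → Rx
  (inj₂ refl) → Rx̄)
  where
  nonzero-member : ∀ y → R y → y ≡ x ⊎ y ≡ ‾ x
  nonzero-member y Ry with members y Ry
  ... | inj₁ refl = ⊥-elim (¬R𝟎 Ry)
  ... | inj₂ y≡x⊎x̄ = y≡x⊎x̄

lemma16 : (n : ℕ) (R : Relation n) → Decidable R →
          (∃[ x ] ∃[ y ] (R x × R y × ¬ R (x ⋁ y))) →
          ((p : PartialConfig n) → NonEmptyDom p → PinningJoinClosed R p) →
          ∃[ x ] ((∀ y → R y ⇔ (y ≡ 𝟎 ⊎ y ≡ x ⊎ y ≡ ‾ x))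
                  ⊎ (∀ y → R y ⇔ (y ≡ x ⊎ y ≡ ‾ x)))
lemma16 n R R? (x , y , Rx , Ry , ¬Rx⋁y) pinClosed =
  x , shape-of-relation R? Rx Rx̄ (members⊆𝟎-x-x̄ closed Rx Rx̄ ¬Rx⋁x̄)
  where
  closed : AgreeingJoinClosed R
  closed = pinnings⇒agreeingJoinClosed R pinClosed

  y≡x̄ : y ≡ ‾ x
  y≡x̄ = nonJoinable⇒complement closed Rx Ry ¬Rx⋁y

  Rx̄ : R (‾ x)
  Rx̄ = subst R y≡x̄ Ry

  ¬Rx⋁x̄ : ¬ R (x ⋁ (‾ x))
  ¬Rx⋁x̄ = subst (λ w → ¬ R (x ⋁ w)) y≡x̄ ¬Rx⋁y
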